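{- Let $A,B$ be objects and $f,g\colon A\to B$ maps of the theory $\mathbf{PR}$. If $$\mathbf{PR}\vdash \mathrm{true}_A=[\,f(a)\doteq_B g(a)\,]\colon A\xrightarrow{\Delta}A\times A\xrightarrow{f\times g}B\times B\xrightarrow{\doteq_B}\mathbf 2,$$ then $\mathbf{PR}\vdash f=g\colon A\to B$.
   Context: $\mathbf{PR}$ is the variable-free categorical theory of primitive recursion: its objects are generated from a terminal object $\mathbf 1$ and a natural numbers object $\mathbb N$ by binary products $A\times B$; its maps are generated from $0\colon\mathbf 1\to\mathbb N$, $\mathrm s\colon\mathbb N\to\mathbb N$, identities, composition, terminal maps $\Pi_A\colon A\to\mathbf 1$, projections $\ell\colon A\times B\to A$, $\mathrm r\colon A\times B\to B$, induced maps $(f,g)\colon C\to A\times B$, and iterates $f^{\S}\colon A\times\mathbb N\to A$ of endomaps $f\colon A\to A$. Its equations are the category axioms, equality is an equivalence compatible with all constructions, the cartesian axioms ($\Pi$ unique; $\ell\circ(f,g)=f$, $\mathrm r\circ(f,g)=g$; surjective pairing $(\ell h,\mathrm r h)=h$), the iteration equations $f^{\S}(a,0)=a$, $f^{\S}(a,\mathrm s n)=f(f^{\S}(a,n))$, and Freyd's uniqueness scheme: if $h\colon A\times\mathbb N\to B$ satisfies $h(a,0)=f(a)$ and $h(a,\mathrm s n)=g(h(a,n))$ for $f\colon A\to B$, $g\colon B\to B$, then $h=g^{\S}\circ(f\times\mathbb N)$. Free variables denote (nested) projections. Truth values are $0=\mathrm{false}$, $1=\mathrm{true}$ in $\mathbb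 N$ ($\mathbf 2$ denotes $\mathbb N$ viewed as truth object, i.e. values $\le 1$); $\mathrm{true}_A=1\circ\Pi_A$. With truncated subtraction $\dot-$, $\neg n$ ($\neg 0=1$, $\neg \mathrm s n=0$), $[m\le n]=\neg[m\dot- n]$, $a\wedge b=\mathrm{sign}(a\cdot b)$, predicative equality on $\mathbb N$ is $[m\doteq n]=[m\le n]\wedge[n\le m]$; it extends componentwise to products, $[(a,b)\doteq_{A\times B}(a',b')]=[a\doteq_A a']\wedge[b\doteq_B b']$, and $\doteq_{\mathbf 1}$ is constantly true. -}

module Defs where

infixr 6 _⊗_
infixr 9 _∘_
infix 4 _≈_

data Obj : Set where
  𝟏   : Obj
  Nat : Obj
  _⊗_ : Obj → Obj → Obj

data Map : Obj → Obj → Set where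
  id    : ∀ {A} → Map A A
  _∘_   : ∀ {A B C} → Map B C → Map A B → Map A C
  Π     : ∀ {A} → Map A 𝟏
  ℓ     : ∀ {A B} → Map (A ⊗ B) A
  r     : ∀ {A B} → Map (A ⊗ B) B
  ⟨_,_⟩ : ∀ {A B C} → Map C A → Map C B → Map C (A ⊗ B)
  zero  : Map 𝟏 Nat
  succ  : Map Nat Nat
  iter  : ∀ {A} → Map A A → Map (A ⊗ Nat) A

_×ᵐ_ : ∀ {A B C D} → Map A C → Map B D → Map (A ⊗ B) (C ⊗ D)
f ×ᵐ g = ⟨ f ∘ ℓ , g ∘ r ⟩

Δ : ∀ {A} → Map A (A ⊗ A)
Δ = ⟨ id , id ⟩

data _≈_ : ∀ {A B} → Map A B → Map A B → Set where
  ≈-refl  : ∀ {A B} {f : Map A B} → f ≈ f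
  ≈-sym   : ∀ {A B} {f g : Map A B} → f ≈ g → g ≈ f
  ≈-trans : ∀ {A B} {f g h : Map A B} → f ≈ g → g ≈ h → f ≈ h
  ∘-cong    : ∀ {A B C} {f f' : Map B C} {g g' : Map A B} → f ≈ f' → g ≈ g' → f ∘ g ≈ f' ∘ g'
  ⟨⟩-cong   : ∀ {A B C} {f f' : Map C A} {g g' : Map C B} → f ≈ f' → g ≈ g' → ⟨ f , g ⟩ ≈ ⟨ f' , g' ⟩
  iter-cong : ∀ {A} {f f' : Map A A} → f ≈ f' → iter f ≈ iter f'
  idˡ   : ∀ {A B} {f : Map A B} → id ∘ f ≈ f
  idʳ   : ∀ {A B} {f : Map A B} → f ∘ id ≈ f
  assoc : ∀ {A B C D} {f : Map C D} {g : Map B C} {h : Map A B} → (f ∘ g) ∘ h ≈ f ∘ (g ∘ h)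
  Π-unique : ∀ {A} {f : Map A 𝟏} → f ≈ Π
  ℓ-β      : ∀ {A B C} {f : Map C A} {g : Map C B} → ℓ ∘ ⟨ f , g ⟩ ≈ f
  r-β      : ∀ {A B C} {f : Map C A} {g : Map C B} → r ∘ ⟨ f , g ⟩ ≈ g
  ⟨⟩-η     : ∀ {A B C} {h : Map C (A ⊗ B)} → ⟨ ℓ ∘ h , r ∘ h ⟩ ≈ h
  iter-0 : ∀ {A} {f : Map A A} → iter f ∘ ⟨ id , zero ∘ Π ⟩ ≈ id
  iter-s : ∀ {A} {f : Map A A} → iter f ∘ (id ×ᵐ succ) ≈ f ∘ iter f
  freyd : ∀ {A B} {h : Map (A ⊗ Nat) B} {f : Map A B} {g : Map B B} →
          h ∘ ⟨ id , zero ∘ Π ⟩ ≈ f →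
          h ∘ (id ×ᵐ succ) ≈ g ∘ h →
          h ≈ iter g ∘ (f ×ᵐ id)

one : Map 𝟏 Nat
one = succ ∘ zero

true : ∀ {A} → Map A Nat
true = one ∘ Π

-- predecessor: iterate (x,y) ↦ (y, s y) from (0,0), take first component
pred : Map Nat Nat
pred = ℓ ∘ iter ⟨ r , succ ∘ r ⟩ ∘ ⟨ ⟨ zero ∘ Π , zero ∘ Π ⟩ , id ⟩

-- truncated subtraction  m ∸ n = pred^n(m)
monus : Map (Nat ⊗ Nat) Nat
monus = iter pred

-- ¬ 0 = 1, ¬ (s n) = 0
neg : Map Nat Nat
neg = iter (zero ∘ Π) ∘ ⟨ one ∘ Π , id ⟩

add : Map (Nat ⊗ Nat) Nat
add = iter succ

-- multiplication  m · n : iterate (m,x) ↦ (m, x + m) n times from (m,0)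
mult : Map (Nat ⊗ Nat) Nat
mult = r ∘ iter ⟨ ℓ , add ∘ ⟨ r , ℓ ⟩ ⟩ ∘ ⟨ ⟨ ℓ , zero ∘ Π ⟩ , r ⟩

sign : Map Nat Nat
sign = neg ∘ neg

leq : Map (Nat ⊗ Nat) Nat
leq = neg ∘ monus

and : Map (Nat ⊗ Nat) Nat
and = sign ∘ mult

peq : (A : Obj) → Map (A ⊗ A) Nat
peq 𝟏 = true
peq Nat = and ∘ ⟨ leq , leq ∘ ⟨ r , ℓ ⟩ ⟩
peq (A ⊗ B) = and ∘ ⟨ peq A ∘ ⟨ ℓ ∘ ℓ , ℓ ∘ r ⟩ , peq B ∘ ⟨ r ∘ ℓ , r ∘ r ⟩ ⟩

module Submission where

open import Defs
open import Data.List using (List; []; _∷_)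
open import Data.Unit using (⊤; tt)
open import Data.Product using (_×_; _,_; proj₁; proj₂)

-- We reason with generalised elements: a point of A at stage X is a map X → A, and
-- every law below holds for points at an arbitrary stage.  The key step is Goodstein's
-- uniqueness of diagonal recursion, which gives a + (b ∸ a) = b + (a ∸ b) and hence
-- a ∸ b = 0 ∧ b ∸ a = 0 ⇒ a = b (monus-antisym).  Since ≐ takes truth values and a true
-- conjunction of truth values has true conjuncts, true = [f ≐_B g] forces f = g by
-- induction on B (peq-reflects); the theorem is the instance at the point Δ.

infix  1 begin_
infixr 2 _≈⟨_⟩_
infix  3 _∎
infixr 4 _⟩∘⟨_

begin_ : ∀ {A B} {f g : Map A B} → f ≈ g → f ≈ g
begin p = p

_≈⟨_⟩_ : ∀ {A B} (f : Map A B) {g h : Map A B} → f ≈ g → g ≈ h → f ≈ h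
f ≈⟨ p ⟩ q = ≈-trans p q

_∎ : ∀ {A B} (f : Map A B) → f ≈ f
f ∎ = ≈-refl

refl : ∀ {A B} {f : Map A B} → f ≈ f
refl = ≈-refl

sym : ∀ {A B} {f g : Map A B} → f ≈ g → g ≈ f
sym = ≈-sym

trans : ∀ {A B} {f g h : Map A B} → f ≈ g → g ≈ h → f ≈ h
trans = ≈-trans

_⟩∘⟨_ : ∀ {A B C} {f f' : Map B C} {g g' : Map A B} → f ≈ f' → g ≈ g' → f ∘ g ≈ f' ∘ g'
_⟩∘⟨_ = ∘-cong

pair-∘ : ∀ {A B C D} {f : Map C A} {g : Map C B} {h : Map D C} →
         ⟨ f , g ⟩ ∘ h ≈ ⟨ f ∘ h , g ∘ h ⟩
pair-∘ = trans (sym ⟨⟩-η) (⟨⟩-cong (trans (sym assoc) (ℓ-β ⟩∘⟨ refl))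
                                   (trans (sym assoc) (r-β ⟩∘⟨ refl)))

×-∘-pair : ∀ {X A B C D} {a : Map A C} {b : Map B D} {f : Map X A} {g : Map X B} →
           (a ×ᵐ b) ∘ ⟨ f , g ⟩ ≈ ⟨ a ∘ f , b ∘ g ⟩
×-∘-pair = trans pair-∘ (⟨⟩-cong (trans assoc (refl ⟩∘⟨ ℓ-β)) (trans assoc (refl ⟩∘⟨ r-β)))

const-∘ : ∀ {X Y B} {c : Map 𝟏 B} {h : Map Y X} → (c ∘ Π) ∘ h ≈ c ∘ Π
const-∘ = trans assoc (refl ⟩∘⟨ Π-unique)

ℓ-graph : ∀ {X B C} {f : Map X C} {u : Map X B} → (f ∘ ℓ) ∘ ⟨ id , u ⟩ ≈ f
ℓ-graph = trans assoc (trans (refl ⟩∘⟨ ℓ-β) idʳ)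

assoc³ : ∀ {A B C D E} {f : Map D E} {g : Map C D} {h : Map B C} {k : Map A B} →
         (f ∘ (g ∘ h)) ∘ k ≈ f ∘ (g ∘ (h ∘ k))
assoc³ = trans assoc (refl ⟩∘⟨ assoc)

Z : ∀ {X} → Map X Nat
Z = zero ∘ Π

S : ∀ {X} → Map X Nat → Map X Nat
S a = succ ∘ a

true≈S0 : ∀ {X} → true {X} ≈ S Z
true≈S0 = assoc

iter-zero : ∀ {X A} {f : Map A A} {a : Map X A} → iter f ∘ ⟨ a , Z ⟩ ≈ a
iter-zero {f = f} {a} = begin
  iter f ∘ ⟨ a , Z ⟩          ≈⟨ refl ⟩∘⟨ sym (trans pair-∘ (⟨⟩-cong idˡ const-∘)) ⟩
  iter f ∘ (⟨ id , Z ⟩ ∘ a)   ≈⟨ sym assoc ⟩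
  (iter f ∘ ⟨ id , Z ⟩) ∘ a   ≈⟨ iter-0 ⟩∘⟨ refl ⟩
  id ∘ a                      ≈⟨ idˡ ⟩
  a                           ∎

id×succ-∘ : ∀ {X A} {a : Map X A} {n : Map X Nat} → (id ×ᵐ succ) ∘ ⟨ a , n ⟩ ≈ ⟨ a , S n ⟩
id×succ-∘ = trans ×-∘-pair (⟨⟩-cong idˡ refl)

iter-succ : ∀ {X A} {f : Map A A} {a : Map X A} {n : Map X Nat} →
            iter f ∘ ⟨ a , S n ⟩ ≈ f ∘ (iter f ∘ ⟨ a , n ⟩)
iter-succ {f = f} {a} {n} = begin
  iter f ∘ ⟨ a , S n ⟩                ≈⟨ refl ⟩∘⟨ sym id×succ-∘ ⟩
  iter f ∘ ((id ×ᵐ succ) ∘ ⟨ a , n ⟩) ≈⟨ sym assoc ⟩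
  (iter f ∘ (id ×ᵐ succ)) ∘ ⟨ a , n ⟩ ≈⟨ iter-s ⟩∘⟨ refl ⟩
  (f ∘ iter f) ∘ ⟨ a , n ⟩            ≈⟨ assoc ⟩
  f ∘ (iter f ∘ ⟨ a , n ⟩)            ∎

-- Their graphs ⟨ id , h ⟩ and ⟨ id , k ⟩ are iterates of one endomap of (X ⊗ ℕ) ⊗ B.
recursion-unique : ∀ {X B} (h k : Map (X ⊗ Nat) B) (G : Map ((X ⊗ Nat) ⊗ B) B) →
  h ∘ ⟨ id , Z ⟩ ≈ k ∘ ⟨ id , Z ⟩ →
  h ∘ ⟨ ℓ , S r ⟩ ≈ G ∘ ⟨ id , h ⟩ →
  k ∘ ⟨ ℓ , S r ⟩ ≈ G ∘ ⟨ id , k ⟩ →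
  h ≈ k
recursion-unique {X} {B} h k G base h-step k-step = begin
  h              ≈⟨ sym r-β ⟩
  r ∘ ⟨ id , h ⟩ ≈⟨ refl ⟩∘⟨ graphs-agree ⟩
  r ∘ ⟨ id , k ⟩ ≈⟨ r-β ⟩
  k              ∎
  where
  step : Map ((X ⊗ Nat) ⊗ B) ((X ⊗ Nat) ⊗ B)
  step = ⟨ ⟨ ℓ ∘ ℓ , S (r ∘ ℓ) ⟩ , G ⟩

  id×succ≈ : (id ×ᵐ succ) ≈ ⟨ ℓ {X} {Nat} , S r ⟩
  id×succ≈ = ⟨⟩-cong idˡ refl

  next-argument : ∀ (u : Map (X ⊗ Nat) B) → ⟨ ℓ ∘ ℓ , S (r ∘ ℓ) ⟩ ∘ ⟨ id , u ⟩ ≈ ⟨ ℓ , S r ⟩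
  next-argument u = trans pair-∘ (⟨⟩-cong ℓ-graph (trans assoc (refl ⟩∘⟨ ℓ-graph)))

  graph-step : ∀ u → u ∘ ⟨ ℓ , S r ⟩ ≈ G ∘ ⟨ id , u ⟩ →
               ⟨ id , u ⟩ ∘ (id ×ᵐ succ) ≈ step ∘ ⟨ id , u ⟩
  graph-step u u-step = begin
    ⟨ id , u ⟩ ∘ (id ×ᵐ succ)
      ≈⟨ pair-∘ ⟩
    ⟨ id ∘ (id ×ᵐ succ) , u ∘ (id ×ᵐ succ) ⟩
      ≈⟨ ⟨⟩-cong (trans idˡ id×succ≈) (trans (refl ⟩∘⟨ id×succ≈) u-step) ⟩
    ⟨ ⟨ ℓ , S r ⟩ , G ∘ ⟨ id , u ⟩ ⟩
      ≈⟨ ⟨⟩-cong (sym (next-argument u)) refl ⟩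
    ⟨ ⟨ ℓ ∘ ℓ , S (r ∘ ℓ) ⟩ ∘ ⟨ id , u ⟩ , G ∘ ⟨ id , u ⟩ ⟩
      ≈⟨ sym pair-∘ ⟩
    step ∘ ⟨ id , u ⟩ ∎

  base-graph : ⟨ id , h ⟩ ∘ ⟨ id , Z ⟩ ≈ ⟨ id , k ⟩ ∘ ⟨ id , Z ⟩
  base-graph = trans pair-∘ (trans (⟨⟩-cong refl base) (sym pair-∘))

  graphs-agree : ⟨ id , h ⟩ ≈ ⟨ id , k ⟩
  graphs-agree = trans (freyd refl (graph-step h h-step))
                 (trans (refl ⟩∘⟨ ⟨⟩-cong (base-graph ⟩∘⟨ refl) refl)
                        (sym (freyd refl (graph-step k k-step))))

cases-unique : ∀ {X B} (h k : Map (X ⊗ Nat) B) →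
  h ∘ ⟨ id , Z ⟩ ≈ k ∘ ⟨ id , Z ⟩ →
  h ∘ ⟨ ℓ , S r ⟩ ≈ k ∘ ⟨ ℓ , S r ⟩ →
  h ≈ k
cases-unique h k base succ-case =
  recursion-unique h k (h ∘ ⟨ ℓ , S r ⟩ ∘ ℓ) base (ignores-previous h refl) (ignores-previous k (sym succ-case))
  where
  ignores-previous : ∀ u → u ∘ ⟨ ℓ , S r ⟩ ≈ h ∘ ⟨ ℓ , S r ⟩ →
                     u ∘ ⟨ ℓ , S r ⟩ ≈ (h ∘ ⟨ ℓ , S r ⟩ ∘ ℓ) ∘ ⟨ id , u ⟩
  ignores-previous u p = trans p (sym (trans (sym assoc ⟩∘⟨ refl) ℓ-graph))

-- Terms with variables over a context of objects.  In an environment of points at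
-- stage Y a term denotes a point at stage Y; this lets us state laws "for all x, y".
data Var : List Obj → Obj → Set where
  vz : ∀ {Γ A} → Var (A ∷ Γ) A
  vs : ∀ {Γ A B} → Var Γ A → Var (B ∷ Γ) A

infixr 5 _·_
data Tm (Γ : List Obj) : Obj → Set where
  var   : ∀ {A} → Var Γ A → Tm Γ A
  _·_   : ∀ {A B} → Map A B → Tm Γ A → Tm Γ B
  ⟪_,_⟫ : ∀ {A B} → Tm Γ A → Tm Γ B → Tm Γ (A ⊗ B)
  ∗     : Tm Γ 𝟏

v0 : ∀ {Γ A} → Tm (A ∷ Γ) A
v0 = var vz

v1 : ∀ {Γ A B} → Tm (B ∷ A ∷ Γ) A
v1 = var (vs vz)

v2 : ∀ {Γ A B C} → Tm (C ∷ B ∷ A ∷ Γ) A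
v2 = var (vs (vs vz))

v3 : ∀ {Γ A B C D} → Tm (D ∷ C ∷ B ∷ A ∷ Γ) A
v3 = var (vs (vs (vs vz)))

zeroₜ : ∀ {Γ} → Tm Γ Nat
zeroₜ = zero · ∗

Env : Obj → List Obj → Set
Env Y []      = ⊤
Env Y (A ∷ Γ) = Map Y A × Env Y Γ

lookup : ∀ {Y Γ A} → Var Γ A → Env Y Γ → Map Y A
lookup vz     (a , _) = a
lookup (vs x) (_ , ρ) = lookup x ρ

⟦_⟧ : ∀ {Y Γ A} → Tm Γ A → Env Y Γ → Map Y A
⟦ var x ⟧     ρ = lookup x ρ
⟦ f · t ⟧     ρ = f ∘ ⟦ t ⟧ ρ
⟦ ⟪ t , u ⟫ ⟧ ρ = ⟨ ⟦ t ⟧ ρ , ⟦ u ⟧ ρ ⟩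
⟦ ∗ ⟧         ρ = Π

_∘ₑ_ : ∀ {Y W Γ} → Env Y Γ → Map W Y → Env W Γ
_∘ₑ_ {Γ = []}    _       σ = tt
_∘ₑ_ {Γ = A ∷ Γ} (a , ρ) σ = a ∘ σ , ρ ∘ₑ σ

_≈ₑ_ : ∀ {Y Γ} → Env Y Γ → Env Y Γ → Set
_≈ₑ_ {Γ = []}    _       _       = ⊤
_≈ₑ_ {Γ = A ∷ Γ} (a , ρ) (b , σ) = (a ≈ b) × (ρ ≈ₑ σ)

≈ₑ-trans : ∀ {Y Γ} {ρ σ τ : Env Y Γ} → ρ ≈ₑ σ → σ ≈ₑ τ → ρ ≈ₑ τ
≈ₑ-trans {Γ = []}    _        _        = tt
≈ₑ-trans {Γ = A ∷ Γ} (p , ps) (q , qs) = trans p q , ≈ₑ-trans ps qs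

lookup-cong : ∀ {Y Γ A} (x : Var Γ A) {ρ σ : Env Y Γ} → ρ ≈ₑ σ → lookup x ρ ≈ lookup x σ
lookup-cong vz     (p , _)  = p
lookup-cong (vs x) (_ , ps) = lookup-cong x ps

⟦⟧-cong : ∀ {Y Γ A} (t : Tm Γ A) {ρ σ : Env Y Γ} → ρ ≈ₑ σ → ⟦ t ⟧ ρ ≈ ⟦ t ⟧ σ
⟦⟧-cong (var x)     p = lookup-cong x p
⟦⟧-cong (f · t)     p = refl ⟩∘⟨ ⟦⟧-cong t p
⟦⟧-cong ⟪ t , u ⟫   p = ⟨⟩-cong (⟦⟧-cong t p) (⟦⟧-cong u p)
⟦⟧-cong ∗           p = refl

lookup-∘ : ∀ {Y W Γ A} (x : Var Γ A) (ρ : Env Y Γ) (σ : Map W Y) →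
           lookup x ρ ∘ σ ≈ lookup x (ρ ∘ₑ σ)
lookup-∘ vz     (a , ρ) σ = refl
lookup-∘ (vs x) (a , ρ) σ = lookup-∘ x ρ σ

⟦⟧-∘ : ∀ {Y W Γ A} (t : Tm Γ A) (ρ : Env Y Γ) (σ : Map W Y) → ⟦ t ⟧ ρ ∘ σ ≈ ⟦ t ⟧ (ρ ∘ₑ σ)
⟦⟧-∘ (var x)   ρ σ = lookup-∘ x ρ σ
⟦⟧-∘ (f · t)   ρ σ = trans assoc (refl ⟩∘⟨ ⟦⟧-∘ t ρ σ)
⟦⟧-∘ ⟪ t , u ⟫ ρ σ = trans pair-∘ (⟨⟩-cong (⟦⟧-∘ t ρ σ) (⟦⟧-∘ u ρ σ))
⟦⟧-∘ ∗         ρ σ = Π-unique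

-- An environment at stage Y is the same as a single point of the product of the context.
∏ : List Obj → Obj
∏ []      = 𝟏
∏ (A ∷ Γ) = A ⊗ ∏ Γ

unpack : ∀ {Y} Γ → Map Y (∏ Γ) → Env Y Γ
unpack []      t = tt
unpack (A ∷ Γ) t = ℓ ∘ t , unpack Γ (r ∘ t)

pack : ∀ {Y} Γ → Env Y Γ → Map Y (∏ Γ)
pack []      _       = Π
pack (A ∷ Γ) (a , ρ) = ⟨ a , pack Γ ρ ⟩

unpack-cong : ∀ {Y} Γ {t t' : Map Y (∏ Γ)} → t ≈ t' → unpack Γ t ≈ₑ unpack Γ t'
unpack-cong []      p = tt
unpack-cong (A ∷ Γ) p = (refl ⟩∘⟨ p) , unpack-cong Γ (refl ⟩∘⟨ p)

unpack-pack : ∀ {Y} Γ (ρ : Env Y Γ) → unpack Γ (pack Γ ρ) ≈ₑ ρ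
unpack-pack []      ρ       = tt
unpack-pack (A ∷ Γ) (a , ρ) = ℓ-β , ≈ₑ-trans (unpack-cong Γ r-β) (unpack-pack Γ ρ)

unpack-∘ : ∀ {Y W} Γ (t : Map Y (∏ Γ)) (σ : Map W Y) → (unpack Γ t ∘ₑ σ) ≈ₑ unpack Γ (t ∘ σ)
unpack-∘ []      t σ = tt
unpack-∘ (A ∷ Γ) t σ = assoc , ≈ₑ-trans (unpack-∘ Γ (r ∘ t) σ) (unpack-cong Γ assoc)

module _ {Γ : List Obj} {B : Obj} where

  asMap : Tm (Nat ∷ Γ) B → Map (∏ Γ ⊗ Nat) B
  asMap E = ⟦ E ⟧ (r , unpack Γ ℓ)

  asMap-at : ∀ (E : Tm (Nat ∷ Γ) B) {Y} (t : Map Y (∏ Γ)) (n : Map Y Nat) →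
             asMap E ∘ ⟨ t , n ⟩ ≈ ⟦ E ⟧ (n , unpack Γ t)
  asMap-at E t n = trans (⟦⟧-∘ E (r , unpack Γ ℓ) ⟨ t , n ⟩)
                         (⟦⟧-cong E (r-β , ≈ₑ-trans (unpack-∘ Γ ℓ ⟨ t , n ⟩) (unpack-cong Γ ℓ-β)))

  at-asMap : ∀ (E : Tm (Nat ∷ Γ) B) {Y} (n : Map Y Nat) (ρ : Env Y Γ) →
             ⟦ E ⟧ (n , ρ) ≈ asMap E ∘ ⟨ pack Γ ρ , n ⟩
  at-asMap E n ρ = sym (trans (asMap-at E (pack Γ ρ) n) (⟦⟧-cong E (refl , unpack-pack Γ ρ)))

  asMap-zero : ∀ (E E' : Tm (Nat ∷ Γ) B) → (∀ {Y} (ρ : Env Y Γ) → ⟦ E ⟧ (Z , ρ) ≈ ⟦ E' ⟧ (Z , ρ)) →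
               asMap E ∘ ⟨ id , Z ⟩ ≈ asMap E' ∘ ⟨ id , Z ⟩
  asMap-zero E E' p = trans (asMap-at E id Z) (trans (p (unpack Γ id)) (sym (asMap-at E' id Z)))

  induction : (E E' : Tm (Nat ∷ Γ) B) (G : Tm (B ∷ Nat ∷ Γ) B) →
    (∀ {Y} (ρ : Env Y Γ) → ⟦ E ⟧ (Z , ρ) ≈ ⟦ E' ⟧ (Z , ρ)) →
    (∀ {Y} (n : Map Y Nat) (ρ : Env Y Γ) → ⟦ E ⟧ (S n , ρ) ≈ ⟦ G ⟧ (⟦ E ⟧ (n , ρ) , n , ρ)) →
    (∀ {Y} (n : Map Y Nat) (ρ : Env Y Γ) → ⟦ E' ⟧ (S n , ρ) ≈ ⟦ G ⟧ (⟦ E' ⟧ (n , ρ) , n , ρ)) →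
    ∀ {Y} (n : Map Y Nat) (ρ : Env Y Γ) → ⟦ E ⟧ (n , ρ) ≈ ⟦ E' ⟧ (n , ρ)
  induction E E' G base E-step E'-step n ρ =
    trans (at-asMap E n ρ) (trans (as-maps ⟩∘⟨ refl) (sym (at-asMap E' n ρ)))
    where
    Gₘ : Map ((∏ Γ ⊗ Nat) ⊗ B) B
    Gₘ = ⟦ G ⟧ (r , r ∘ ℓ , unpack Γ (ℓ ∘ ℓ))

    Gₘ-graph : ∀ (u : Map (∏ Γ ⊗ Nat) B) → Gₘ ∘ ⟨ id , u ⟩ ≈ ⟦ G ⟧ (u , r , unpack Γ ℓ)
    Gₘ-graph u = trans (⟦⟧-∘ G (r , r ∘ ℓ , unpack Γ (ℓ ∘ ℓ)) ⟨ id , u ⟩)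
                       (⟦⟧-cong G (r-β , ℓ-graph , ≈ₑ-trans (unpack-∘ Γ (ℓ ∘ ℓ) ⟨ id , u ⟩)
                                                            (unpack-cong Γ ℓ-graph)))

    map-step : ∀ (F : Tm (Nat ∷ Γ) B) →
      (∀ {Y} (n : Map Y Nat) (ρ : Env Y Γ) → ⟦ F ⟧ (S n , ρ) ≈ ⟦ G ⟧ (⟦ F ⟧ (n , ρ) , n , ρ)) →
      asMap F ∘ ⟨ ℓ , S r ⟩ ≈ Gₘ ∘ ⟨ id , asMap F ⟩
    map-step F F-step = trans (asMap-at F ℓ (S r)) (trans (F-step r (unpack Γ ℓ)) (sym (Gₘ-graph (asMap F))))

    as-maps : asMap E ≈ asMap E'
    as-maps = recursion-unique (asMap E) (asMap E') Gₘ (asMap-zero E E' base) (map-step E E-step) (map-step E' E'-step)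

  by-cases : (E E' : Tm (Nat ∷ Γ) B) →
    (∀ {Y} (ρ : Env Y Γ) → ⟦ E ⟧ (Z , ρ) ≈ ⟦ E' ⟧ (Z , ρ)) →
    (∀ {Y} (n : Map Y Nat) (ρ : Env Y Γ) → ⟦ E ⟧ (S n , ρ) ≈ ⟦ E' ⟧ (S n , ρ)) →
    ∀ {Y} (n : Map Y Nat) (ρ : Env Y Γ) → ⟦ E ⟧ (n , ρ) ≈ ⟦ E' ⟧ (n , ρ)
  by-cases E E' base succ-case n ρ =
    trans (at-asMap E n ρ) (trans (as-maps ⟩∘⟨ refl) (sym (at-asMap E' n ρ)))
    where
    as-maps : asMap E ≈ asMap E'
    as-maps = cases-unique (asMap E) (asMap E') (asMap-zero E E' base)
      (trans (asMap-at E ℓ (S r)) (trans (succ-case r (unpack Γ ℓ)) (sym (asMap-at E' ℓ (S r)))))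

shift : Map (Nat ⊗ Nat) (Nat ⊗ Nat)
shift = ⟨ r , succ ∘ r ⟩

pred-at : ∀ {X} {a : Map X Nat} → pred ∘ a ≈ ℓ ∘ (iter shift ∘ ⟨ ⟨ Z , Z ⟩ , a ⟩)
pred-at = trans assoc³ (refl ⟩∘⟨ refl ⟩∘⟨ trans pair-∘ (⟨⟩-cong (trans pair-∘ (⟨⟩-cong const-∘ const-∘)) idˡ))

shift-counts : ∀ {X} (n : Map X Nat) → r ∘ (iter shift ∘ ⟨ ⟨ Z , Z ⟩ , n ⟩) ≈ n
shift-counts n = induction {Γ = []} (r · iter shift · ⟪ ⟪ zeroₜ , zeroₜ ⟫ , v0 ⟫) v0 (succ · v0)
  (λ ρ → trans (refl ⟩∘⟨ iter-zero) r-β)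
  (λ n ρ → trans (refl ⟩∘⟨ iter-succ) (trans (sym assoc) (trans (r-β ⟩∘⟨ refl) assoc)))
  (λ n ρ → refl) n tt

pred-zero : ∀ {X} → pred ∘ Z {X} ≈ Z
pred-zero = trans pred-at (trans (refl ⟩∘⟨ iter-zero) ℓ-β)

pred-succ : ∀ {X} {a : Map X Nat} → pred ∘ S a ≈ a
pred-succ {a = a} = trans pred-at (trans (refl ⟩∘⟨ iter-succ) (trans (sym assoc) (trans (ℓ-β ⟩∘⟨ refl) (shift-counts a))))

add-zero : ∀ {X} {a : Map X Nat} → add ∘ ⟨ a , Z ⟩ ≈ a
add-zero = iter-zero

add-succ : ∀ {X} {a b : Map X Nat} → add ∘ ⟨ a , S b ⟩ ≈ S (add ∘ ⟨ a , b ⟩)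
add-succ = iter-succ

add-zeroˡ : ∀ {X} (b : Map X Nat) → add ∘ ⟨ Z , b ⟩ ≈ b
add-zeroˡ b = induction {Γ = []} (add · ⟪ zeroₜ , v0 ⟫) v0 (succ · v0)
  (λ ρ → add-zero) (λ n ρ → add-succ) (λ n ρ → refl) b tt

add-succˡ : ∀ {X} (a b : Map X Nat) → add ∘ ⟨ S a , b ⟩ ≈ S (add ∘ ⟨ a , b ⟩)
add-succˡ a b = induction {Γ = Nat ∷ []} (add · ⟪ succ · v1 , v0 ⟫) (succ · add · ⟪ v1 , v0 ⟫) (succ · v0)
  (λ ρ → trans add-zero (sym (refl ⟩∘⟨ add-zero))) (λ n ρ → add-succ) (λ n ρ → refl ⟩∘⟨ add-succ) b (a , tt)

monus-zero : ∀ {X} {a : Map X Nat} → monus ∘ ⟨ a , Z ⟩ ≈ a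
monus-zero = iter-zero

monus-succ : ∀ {X} {a b : Map X Nat} → monus ∘ ⟨ a , S b ⟩ ≈ pred ∘ (monus ∘ ⟨ a , b ⟩)
monus-succ = iter-succ

monus-zeroˡ : ∀ {X} (b : Map X Nat) → monus ∘ ⟨ Z , b ⟩ ≈ Z
monus-zeroˡ b = induction {Γ = []} (monus · ⟪ zeroₜ , v0 ⟫) zeroₜ (pred · v0)
  (λ ρ → monus-zero) (λ n ρ → monus-succ) (λ n ρ → sym pred-zero) b tt

pred-monus : ∀ {X} (c a : Map X Nat) → pred ∘ (monus ∘ ⟨ c , a ⟩) ≈ monus ∘ ⟨ pred ∘ c , a ⟩
pred-monus c a = induction {Γ = Nat ∷ []} (pred · monus · ⟪ v1 , v0 ⟫) (monus · ⟪ pred · v1 , v0 ⟫) (pred · v0)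
  (λ ρ → trans (refl ⟩∘⟨ monus-zero) (sym monus-zero)) (λ n ρ → refl ⟩∘⟨ monus-succ) (λ n ρ → monus-succ) a (c , tt)

monus-succ-succ : ∀ {X} {b a : Map X Nat} → monus ∘ ⟨ S b , S a ⟩ ≈ monus ∘ ⟨ b , a ⟩
monus-succ-succ {b = b} {a} = trans monus-succ (trans (pred-monus (S b) a) (refl ⟩∘⟨ ⟨⟩-cong pred-succ refl))

monus-self : ∀ {X} (y : Map X Nat) → monus ∘ ⟨ y , y ⟩ ≈ Z
monus-self y = induction {Γ = []} (monus · ⟪ v0 , v0 ⟫) zeroₜ v0
  (λ ρ → monus-zero) (λ n ρ → monus-succ-succ) (λ n ρ → refl) y tt

-- The conditional  ifz((a , b) , n) = a if n = 0, and b otherwise.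
ifz : ∀ {B} → Map ((B ⊗ B) ⊗ Nat) B
ifz = ℓ ∘ iter ⟨ r , r ⟩

ifz-zero : ∀ {X B} {a b : Map X B} → ifz ∘ ⟨ ⟨ a , b ⟩ , Z ⟩ ≈ a
ifz-zero = trans assoc (trans (refl ⟩∘⟨ iter-zero) ℓ-β)

swap-keeps-r : ∀ {X B} (p : Map X (B ⊗ B)) (n : Map X Nat) → r ∘ (iter ⟨ r , r ⟩ ∘ ⟨ p , n ⟩) ≈ r ∘ p
swap-keeps-r {B = B} p n = induction {Γ = B ⊗ B ∷ []} (r · iter ⟨ r , r ⟩ · ⟪ v1 , v0 ⟫) (r · v1) v0
  (λ ρ → refl ⟩∘⟨ iter-zero) (λ n ρ → trans (refl ⟩∘⟨ iter-succ) (trans (sym assoc) (r-β ⟩∘⟨ refl))) (λ n ρ → refl)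
  n (p , tt)

ifz-succ : ∀ {X B} {a b : Map X B} {c : Map X Nat} → ifz ∘ ⟨ ⟨ a , b ⟩ , S c ⟩ ≈ b
ifz-succ {a = a} {b} {c} =
  trans assoc (trans (refl ⟩∘⟨ iter-succ) (trans (sym assoc) (trans (ℓ-β ⟩∘⟨ refl) (trans (swap-keeps-r ⟨ a , b ⟩ c) r-β))))

ifz-same : ∀ {X B} (a : Map X B) (n : Map X Nat) → ifz ∘ ⟨ ⟨ a , a ⟩ , n ⟩ ≈ a
ifz-same {B = B} a n = by-cases {Γ = B ∷ []} (ifz · ⟪ ⟪ v1 , v1 ⟫ , v0 ⟫) v1 (λ ρ → ifz-zero) (λ n ρ → ifz-succ) n (a , tt)

mult-step : Map (Nat ⊗ Nat) (Nat ⊗ Nat)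
mult-step = ⟨ ℓ , add ∘ ⟨ r , ℓ ⟩ ⟩

mult-at : ∀ {X} {a b : Map X Nat} → mult ∘ ⟨ a , b ⟩ ≈ r ∘ (iter mult-step ∘ ⟨ ⟨ a , Z ⟩ , b ⟩)
mult-at = trans assoc³ (refl ⟩∘⟨ refl ⟩∘⟨ trans pair-∘ (⟨⟩-cong (trans pair-∘ (⟨⟩-cong ℓ-β const-∘)) r-β))

mult-zeroʳ : ∀ {X} {a : Map X Nat} → mult ∘ ⟨ a , Z ⟩ ≈ Z
mult-zeroʳ = trans mult-at (trans (refl ⟩∘⟨ iter-zero) r-β)

mult-zeroˡ : ∀ {X} (b : Map X Nat) → mult ∘ ⟨ Z , b ⟩ ≈ Z
mult-zeroˡ b = trans mult-at (trans (refl ⟩∘⟨ stays-zero) r-β)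
  where
  step-zero : ∀ {X} → mult-step ∘ ⟨ Z , Z ⟩ ≈ ⟨ Z {X} , Z ⟩
  step-zero = trans pair-∘ (⟨⟩-cong ℓ-β (trans assoc (trans (refl ⟩∘⟨ trans pair-∘ (⟨⟩-cong r-β ℓ-β)) add-zero)))

  stays-zero : iter mult-step ∘ ⟨ ⟨ Z , Z ⟩ , b ⟩ ≈ ⟨ Z , Z ⟩
  stays-zero = induction {Γ = []} (iter mult-step · ⟪ ⟪ zeroₜ , zeroₜ ⟫ , v0 ⟫) ⟪ zeroₜ , zeroₜ ⟫ (mult-step · v0)
    (λ ρ → iter-zero) (λ n ρ → iter-succ) (λ n ρ → sym step-zero) b tt

neg-at : ∀ {X} {a : Map X Nat} → neg ∘ a ≈ iter (zero ∘ Π) ∘ ⟨ one ∘ Π , a ⟩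
neg-at = trans assoc (refl ⟩∘⟨ trans pair-∘ (⟨⟩-cong const-∘ idˡ))

neg-zero : ∀ {X} → neg ∘ Z {X} ≈ true
neg-zero = trans neg-at iter-zero

neg-succ : ∀ {X} {a : Map X Nat} → neg ∘ S a ≈ Z
neg-succ = trans neg-at (trans iter-succ const-∘)

neg-true : ∀ {X} → neg ∘ true {X} ≈ Z
neg-true = trans (refl ⟩∘⟨ true≈S0) neg-succ

sign-zero : ∀ {X} → sign ∘ Z {X} ≈ Z
sign-zero = trans assoc (trans (refl ⟩∘⟨ neg-zero) neg-true)

sign-succ : ∀ {X} {a : Map X Nat} → sign ∘ S a ≈ true
sign-succ = trans assoc (trans (refl ⟩∘⟨ neg-succ) neg-zero)

sign-true : ∀ {X} → sign ∘ true {X} ≈ true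
sign-true = trans (refl ⟩∘⟨ true≈S0) sign-succ

-- A point p is a truth value when sign p = p.  Signs and negations are truth values.
sign-idem : ∀ {X} (w : Map X Nat) → sign ∘ (sign ∘ w) ≈ sign ∘ w
sign-idem w = by-cases {Γ = []} (sign · sign · v0) (sign · v0)
  (λ ρ → refl ⟩∘⟨ sign-zero) (λ n ρ → trans (refl ⟩∘⟨ sign-succ) (trans sign-true (sym sign-succ))) w tt

neg-is-truth-value : ∀ {X} (w : Map X Nat) → neg ∘ w ≈ sign ∘ (neg ∘ w)
neg-is-truth-value w = by-cases {Γ = []} (neg · v0) (sign · neg · v0)
  (λ ρ → trans neg-zero (sym (trans (refl ⟩∘⟨ neg-zero) sign-true)))
  (λ n ρ → trans neg-succ (sym (trans (refl ⟩∘⟨ neg-succ) sign-zero))) w tt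

-- w can be recovered from w and ¬ w; so ¬ w = true forces w = 0.
ifz-neg : ∀ {X} (w : Map X Nat) → ifz ∘ ⟨ ⟨ w , Z ⟩ , neg ∘ w ⟩ ≈ w
ifz-neg w = by-cases {Γ = []} (ifz · ⟪ ⟪ v0 , zeroₜ ⟫ , neg · v0 ⟫) v0
  (λ ρ → trans (refl ⟩∘⟨ ⟨⟩-cong refl (trans neg-zero true≈S0)) ifz-succ)
  (λ n ρ → trans (refl ⟩∘⟨ ⟨⟩-cong refl neg-succ) ifz-zero) w tt

neg-true⇒zero : ∀ {X} (u : Map X Nat) → neg ∘ u ≈ true → u ≈ Z
neg-true⇒zero u p = trans (sym (ifz-neg u)) (trans (refl ⟩∘⟨ ⟨⟩-cong refl (trans p true≈S0)) ifz-succ)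

_∸ₘ_ : ∀ {Y} → Map Y Nat → Map Y Nat → Map Y Nat
a ∸ₘ b = monus ∘ ⟨ a , b ⟩

-- Any two solutions agree: both are computed by the same
-- ordinary recursion climbing the diagonal from the axis to (x , y).
module DiagonalRecursion {B : Obj} (F : Map (Nat ⊗ Nat) B) (H : Map B B) where

  record IsSolution (G : Map (Nat ⊗ Nat) B) : Set where
    field
      on-left-axis  : ∀ {Y} (b : Map Y Nat) → G ∘ ⟨ Z , b ⟩ ≈ F ∘ ⟨ Z , b ⟩
      on-right-axis : ∀ {Y} (a : Map Y Nat) → G ∘ ⟨ a , Z ⟩ ≈ F ∘ ⟨ a , Z ⟩
      diagonal      : ∀ {Y} (a b : Map Y Nat) → G ∘ ⟨ S a , S b ⟩ ≈ H ∘ (G ∘ ⟨ a , b ⟩)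

  -- The value of a solution at (a , b), given its value v at (a - 1 , b - 1).
  stepₜ : ∀ {Γ} → Tm Γ Nat → Tm Γ Nat → Tm Γ B → Tm Γ B
  stepₜ a b v = ifz · ⟪ ⟪ F · ⟪ zeroₜ , b ⟫ , ifz · ⟪ ⟪ F · ⟪ a , zeroₜ ⟫ , H · v ⟫ , b ⟫ ⟫ , a ⟫

  step : ∀ {Y} → Map Y Nat → Map Y Nat → Map Y B → Map Y B
  step a b v = ⟦ stepₜ v0 v1 v2 ⟧ (a , b , v , tt)

  step-cong : ∀ {Y} {a a' b b' : Map Y Nat} {v v' : Map Y B} →
              a ≈ a' → b ≈ b' → v ≈ v' → step a b v ≈ step a' b' v'
  step-cong p q s = ⟦⟧-cong (stepₜ v0 v1 v2) (p , q , s , tt)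

  -- descentₜ in the variables n, x, y is  G(x ∸ (y ∸ n) , y ∸ (y ∸ n)):  it starts on the
  -- axis at n = 0, moves one diagonal step per increment of n, and reaches (x , y) at n = y.
  descentₜ : Map (Nat ⊗ Nat) B → Tm (Nat ∷ Nat ∷ Nat ∷ []) B
  descentₜ G = G · ⟪ monus · ⟪ v1 , monus · ⟪ v2 , v0 ⟫ ⟫ , monus · ⟪ v2 , monus · ⟪ v2 , v0 ⟫ ⟫ ⟫

  -- Its recursion step, with v0 the previous value: stay if y ∸ n = 0, else take a step.
  descent-stepₜ : Tm (B ∷ Nat ∷ Nat ∷ Nat ∷ []) B
  descent-stepₜ = ifz · ⟪ ⟪ v0 , stepₜ (monus · ⟪ v2 , pred · monus · ⟪ v3 , v1 ⟫ ⟫)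
                                        (monus · ⟪ v3 , pred · monus · ⟪ v3 , v1 ⟫ ⟫) v0 ⟫
                        , monus · ⟪ v3 , v1 ⟫ ⟫

  module Solution {G : Map (Nat ⊗ Nat) B} (solution : IsSolution G) where
    open IsSolution solution

    off-left-axis : ∀ {Y} (n b : Map Y Nat) →
      G ∘ ⟨ S n , b ⟩ ≈ ifz ∘ ⟨ ⟨ F ∘ ⟨ S n , Z ⟩ , H ∘ (G ∘ ⟨ pred ∘ S n , pred ∘ b ⟩) ⟩ , b ⟩
    off-left-axis n b = by-cases {Γ = Nat ∷ []} (G · ⟪ succ · v1 , v0 ⟫)
      (ifz · ⟪ ⟪ F · ⟪ succ · v1 , zeroₜ ⟫ , H · G · ⟪ pred · succ · v1 , pred · v0 ⟫ ⟫ , v0 ⟫)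
      (λ ρ → trans (on-right-axis _) (sym ifz-zero))
      (λ k ρ → trans (diagonal _ _) (sym (trans ifz-succ (refl ⟩∘⟨ refl ⟩∘⟨ ⟨⟩-cong pred-succ pred-succ))))
      b (n , tt)

    unfold : ∀ {Y} (a b : Map Y Nat) → G ∘ ⟨ a , b ⟩ ≈ step a b (G ∘ ⟨ pred ∘ a , pred ∘ b ⟩)
    unfold a b = by-cases {Γ = Nat ∷ []} (G · ⟪ v0 , v1 ⟫) (stepₜ v0 v1 (G · ⟪ pred · v0 , pred · v1 ⟫))
      (λ ρ → trans (on-left-axis _) (sym ifz-zero))
      (λ n ρ → trans (off-left-axis n _) (sym ifz-succ))
      a (b , tt)

    climb : ∀ {Y} (w x y : Map Y Nat) →
      G ∘ ⟨ x ∸ₘ (pred ∘ w) , y ∸ₘ (pred ∘ w) ⟩ ≈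
      ifz ∘ ⟨ ⟨ G ∘ ⟨ x ∸ₘ w , y ∸ₘ w ⟩ ,
                step (x ∸ₘ (pred ∘ w)) (y ∸ₘ (pred ∘ w)) (G ∘ ⟨ x ∸ₘ w , y ∸ₘ w ⟩) ⟩ , w ⟩
    climb w x y = by-cases {Γ = Nat ∷ Nat ∷ []}
      (G · ⟪ monus · ⟪ v1 , pred · v0 ⟫ , monus · ⟪ v2 , pred · v0 ⟫ ⟫)
      (ifz · ⟪ ⟪ G · ⟪ monus · ⟪ v1 , v0 ⟫ , monus · ⟪ v2 , v0 ⟫ ⟫
               , stepₜ (monus · ⟪ v1 , pred · v0 ⟫) (monus · ⟪ v2 , pred · v0 ⟫)
                       (G · ⟪ monus · ⟪ v1 , v0 ⟫ , monus · ⟪ v2 , v0 ⟫ ⟫) ⟫ , v0 ⟫)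
      (λ ρ → trans (refl ⟩∘⟨ ⟨⟩-cong (refl ⟩∘⟨ ⟨⟩-cong refl pred-zero) (refl ⟩∘⟨ ⟨⟩-cong refl pred-zero))
                   (sym ifz-zero))
      (λ { n (x , y , tt) → climb-succ n x y })
      w (x , y , tt)
      where
      climb-succ : ∀ {Y} (n x y : Map Y Nat) →
        G ∘ ⟨ x ∸ₘ (pred ∘ S n) , y ∸ₘ (pred ∘ S n) ⟩ ≈
        ifz ∘ ⟨ ⟨ G ∘ ⟨ x ∸ₘ S n , y ∸ₘ S n ⟩ ,
                  step (x ∸ₘ (pred ∘ S n)) (y ∸ₘ (pred ∘ S n)) (G ∘ ⟨ x ∸ₘ S n , y ∸ₘ S n ⟩) ⟩ , S n ⟩
      climb-succ n x y = begin
        G ∘ ⟨ x ∸ₘ (pred ∘ S n) , y ∸ₘ (pred ∘ S n) ⟩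
          ≈⟨ refl ⟩∘⟨ ⟨⟩-cong (refl ⟩∘⟨ ⟨⟩-cong refl pred-succ) (refl ⟩∘⟨ ⟨⟩-cong refl pred-succ) ⟩
        G ∘ ⟨ x ∸ₘ n , y ∸ₘ n ⟩
          ≈⟨ unfold _ _ ⟩
        step (x ∸ₘ n) (y ∸ₘ n) (G ∘ ⟨ pred ∘ (x ∸ₘ n) , pred ∘ (y ∸ₘ n) ⟩)
          ≈⟨ step-cong (refl ⟩∘⟨ ⟨⟩-cong refl (sym pred-succ)) (refl ⟩∘⟨ ⟨⟩-cong refl (sym pred-succ))
                       (refl ⟩∘⟨ ⟨⟩-cong (sym monus-succ) (sym monus-succ)) ⟩
        step (x ∸ₘ (pred ∘ S n)) (y ∸ₘ (pred ∘ S n)) (G ∘ ⟨ x ∸ₘ S n , y ∸ₘ S n ⟩)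
          ≈⟨ sym ifz-succ ⟩
        ifz ∘ ⟨ ⟨ G ∘ ⟨ x ∸ₘ S n , y ∸ₘ S n ⟩ ,
                  step (x ∸ₘ (pred ∘ S n)) (y ∸ₘ (pred ∘ S n)) (G ∘ ⟨ x ∸ₘ S n , y ∸ₘ S n ⟩) ⟩ , S n ⟩ ∎

    descent-zero : ∀ {Y} (x y : Map Y Nat) → ⟦ descentₜ G ⟧ (Z , x , y , tt) ≈ F ∘ ⟨ x ∸ₘ y , Z ⟩
    descent-zero x y =
      trans (refl ⟩∘⟨ ⟨⟩-cong (refl ⟩∘⟨ ⟨⟩-cong refl monus-zero)
                              (trans (refl ⟩∘⟨ ⟨⟩-cong refl monus-zero) (monus-self y)))
            (on-right-axis _)

    descent-succ : ∀ {Y} (n : Map Y Nat) (ρ : Env Y (Nat ∷ Nat ∷ [])) →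
      ⟦ descentₜ G ⟧ (S n , ρ) ≈ ⟦ descent-stepₜ ⟧ (⟦ descentₜ G ⟧ (n , ρ) , n , ρ)
    descent-succ n (x , y , tt) =
      trans (refl ⟩∘⟨ ⟨⟩-cong (refl ⟩∘⟨ ⟨⟩-cong refl monus-succ) (refl ⟩∘⟨ ⟨⟩-cong refl monus-succ))
            (climb (y ∸ₘ n) x y)

    descent-end : ∀ {Y} (x y : Map Y Nat) → ⟦ descentₜ G ⟧ (y , x , y , tt) ≈ G ∘ ⟨ x , y ⟩
    descent-end x y = refl ⟩∘⟨ ⟨⟩-cong (trans (refl ⟩∘⟨ ⟨⟩-cong refl (monus-self y)) monus-zero)
                                       (trans (refl ⟩∘⟨ ⟨⟩-cong refl (monus-self y)) monus-zero)

  solutions-agree : ∀ {G G'} → IsSolution G → IsSolution G' →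
                    ∀ {Y} (x y : Map Y Nat) → G ∘ ⟨ x , y ⟩ ≈ G' ∘ ⟨ x , y ⟩
  solutions-agree {G} {G'} sol sol' x y = begin
    G ∘ ⟨ x , y ⟩                            ≈⟨ sym (S₁.descent-end x y) ⟩
    ⟦ descentₜ G ⟧ (y , x , y , tt)          ≈⟨ descents-agree ⟩
    ⟦ descentₜ G' ⟧ (y , x , y , tt)         ≈⟨ S₂.descent-end x y ⟩
    G' ∘ ⟨ x , y ⟩                           ∎
    where
    module S₁ = Solution sol
    module S₂ = Solution sol'
    descents-agree : ⟦ descentₜ G ⟧ (y , x , y , tt) ≈ ⟦ descentₜ G' ⟧ (y , x , y , tt)
    descents-agree = induction {Γ = Nat ∷ Nat ∷ []} (descentₜ G) (descentₜ G') descent-stepₜ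
      (λ { (a , b , tt) → trans (S₁.descent-zero a b) (sym (S₂.descent-zero a b)) })
      S₁.descent-succ S₂.descent-succ y (x , y , tt)

-- max computed from either argument:  a + (b ∸ a)  and  b + (a ∸ b).
max-left : Map (Nat ⊗ Nat) Nat
max-left = add ∘ ⟨ ℓ , monus ∘ ⟨ r , ℓ ⟩ ⟩

max-right : Map (Nat ⊗ Nat) Nat
max-right = add ∘ ⟨ r , monus ∘ ⟨ ℓ , r ⟩ ⟩

max-left-at : ∀ {X} {a b : Map X Nat} → max-left ∘ ⟨ a , b ⟩ ≈ add ∘ ⟨ a , b ∸ₘ a ⟩
max-left-at = trans assoc (refl ⟩∘⟨ trans pair-∘ (⟨⟩-cong ℓ-β (trans assoc (refl ⟩∘⟨ trans pair-∘ (⟨⟩-cong r-β ℓ-β)))))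

max-right-at : ∀ {X} {a b : Map X Nat} → max-right ∘ ⟨ a , b ⟩ ≈ add ∘ ⟨ b , a ∸ₘ b ⟩
max-right-at = trans assoc (refl ⟩∘⟨ trans pair-∘ (⟨⟩-cong r-β (trans assoc (refl ⟩∘⟨ trans pair-∘ (⟨⟩-cong ℓ-β r-β)))))

add-monus-succ : ∀ {X} (u v : Map X Nat) → add ∘ ⟨ S u , S v ∸ₘ S u ⟩ ≈ S (add ∘ ⟨ u , v ∸ₘ u ⟩)
add-monus-succ u v = trans (refl ⟩∘⟨ ⟨⟩-cong refl monus-succ-succ) (add-succˡ _ _)

open DiagonalRecursion max-left succ using (IsSolution; solutions-agree)

max-left-solution : IsSolution max-left
max-left-solution = record
  { on-left-axis  = λ b → refl
  ; on-right-axis = λ a → refl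
  ; diagonal      = λ a b → trans max-left-at (trans (add-monus-succ a b) (refl ⟩∘⟨ sym max-left-at))
  }

max-right-solution : IsSolution max-right
max-right-solution = record
  { on-left-axis  = λ b → trans max-right-at (trans (refl ⟩∘⟨ ⟨⟩-cong refl (monus-zeroˡ b))
                          (trans add-zero (sym (trans max-left-at (trans (refl ⟩∘⟨ ⟨⟩-cong refl monus-zero) (add-zeroˡ b))))))
  ; on-right-axis = λ a → trans max-right-at (trans (refl ⟩∘⟨ ⟨⟩-cong refl monus-zero)
                          (trans (add-zeroˡ a) (sym (trans max-left-at (trans (refl ⟩∘⟨ ⟨⟩-cong refl (monus-zeroˡ a)) add-zero)))))
  ; diagonal      = λ a b → trans max-right-at (trans (add-monus-succ b a) (refl ⟩∘⟨ sym max-right-at))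
  }

monus-antisym : ∀ {X} (f g : Map X Nat) → f ∸ₘ g ≈ Z → g ∸ₘ f ≈ Z → f ≈ g
monus-antisym f g f∸g g∸f = begin
  f                         ≈⟨ sym add-zero ⟩
  add ∘ ⟨ f , Z ⟩           ≈⟨ refl ⟩∘⟨ ⟨⟩-cong refl (sym g∸f) ⟩
  add ∘ ⟨ f , g ∸ₘ f ⟩      ≈⟨ sym max-left-at ⟩
  max-left ∘ ⟨ f , g ⟩      ≈⟨ solutions-agree max-left-solution max-right-solution f g ⟩
  max-right ∘ ⟨ f , g ⟩     ≈⟨ max-right-at ⟩
  add ∘ ⟨ g , f ∸ₘ g ⟩      ≈⟨ refl ⟩∘⟨ ⟨⟩-cong refl f∸g ⟩
  add ∘ ⟨ g , Z ⟩           ≈⟨ add-zero ⟩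
  g                         ∎

-- If the conjunction sign a ∧ sign b is true then so is each factor: sign a is
-- recovered from the conjunction by the conditional below (check a = 0 and a = s n).
sign-from-conjunctionˡ : ∀ {X} (a b : Map X Nat) →
  sign ∘ a ≈ ifz ∘ ⟨ ⟨ sign ∘ a , true ⟩ , sign ∘ (mult ∘ ⟨ sign ∘ a , sign ∘ b ⟩) ⟩
sign-from-conjunctionˡ a b = by-cases {Γ = Nat ∷ []} (sign · v0)
  (ifz · ⟪ ⟪ sign · v0 , one · ∗ ⟫ , sign · mult · ⟪ sign · v0 , sign · v1 ⟫ ⟫)
  (λ ρ → sym (trans (refl ⟩∘⟨ ⟨⟩-cong (⟨⟩-cong sign-zero refl)
                     (trans (refl ⟩∘⟨ trans (refl ⟩∘⟨ ⟨⟩-cong sign-zero refl) (mult-zeroˡ _)) sign-zero))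
              (trans ifz-zero (sym sign-zero))))
  (λ n ρ → trans sign-succ (sym (trans (refl ⟩∘⟨ ⟨⟩-cong (⟨⟩-cong sign-succ refl) refl) (ifz-same true _))))
  a (b , tt)

sign-from-conjunctionʳ : ∀ {X} (a b : Map X Nat) →
  sign ∘ b ≈ ifz ∘ ⟨ ⟨ sign ∘ b , true ⟩ , sign ∘ (mult ∘ ⟨ sign ∘ a , sign ∘ b ⟩) ⟩
sign-from-conjunctionʳ a b = by-cases {Γ = Nat ∷ []} (sign · v0)
  (ifz · ⟪ ⟪ sign · v0 , one · ∗ ⟫ , sign · mult · ⟪ sign · v1 , sign · v0 ⟫ ⟫)
  (λ ρ → sym (trans (refl ⟩∘⟨ ⟨⟩-cong (⟨⟩-cong sign-zero refl)
                     (trans (refl ⟩∘⟨ trans (refl ⟩∘⟨ ⟨⟩-cong refl sign-zero) mult-zeroʳ) sign-zero))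
              (trans ifz-zero (sym sign-zero))))
  (λ n ρ → trans sign-succ (sym (trans (refl ⟩∘⟨ ⟨⟩-cong (⟨⟩-cong sign-succ refl) refl) (ifz-same true _))))
  b (a , tt)

conjuncts-true : ∀ {X} (p q : Map X Nat) → p ≈ sign ∘ p → q ≈ sign ∘ q →
                 sign ∘ (mult ∘ ⟨ p , q ⟩) ≈ true → (p ≈ true) × (q ≈ true)
conjuncts-true p q p-tv q-tv pq-true =
  conjunct-true p-tv (sign-from-conjunctionˡ p q) , conjunct-true q-tv (sign-from-conjunctionʳ p q)
  where
  conjunction-true : sign ∘ (mult ∘ ⟨ sign ∘ p , sign ∘ q ⟩) ≈ true
  conjunction-true = trans (refl ⟩∘⟨ refl ⟩∘⟨ ⟨⟩-cong (sym p-tv) (sym q-tv)) pq-true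

  conjunct-true : ∀ {c} → c ≈ sign ∘ c →
    sign ∘ c ≈ ifz ∘ ⟨ ⟨ sign ∘ c , true ⟩ , sign ∘ (mult ∘ ⟨ sign ∘ p , sign ∘ q ⟩) ⟩ → c ≈ true
  conjunct-true c-tv recover =
    trans c-tv (trans recover (trans (refl ⟩∘⟨ ⟨⟩-cong refl (trans conjunction-true true≈S0)) ifz-succ))

and-at : ∀ {X Y} (p q : Map Y Nat) (t : Map X Y) → (and ∘ ⟨ p , q ⟩) ∘ t ≈ sign ∘ (mult ∘ ⟨ p ∘ t , q ∘ t ⟩)
and-at p q t = trans assoc (trans assoc (refl ⟩∘⟨ refl ⟩∘⟨ pair-∘))

conjunction-truth-value : ∀ {X Y} (p q : Map Y Nat) (t : Map X Y) →
                          (and ∘ ⟨ p , q ⟩) ∘ t ≈ sign ∘ ((and ∘ ⟨ p , q ⟩) ∘ t)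
conjunction-truth-value p q t = trans (and-at p q t) (sym (trans (refl ⟩∘⟨ and-at p q t) (sign-idem _)))

peq-truth-value : ∀ B {X} (t : Map X (B ⊗ B)) → peq B ∘ t ≈ sign ∘ (peq B ∘ t)
peq-truth-value 𝟏       t = trans const-∘ (sym (trans (refl ⟩∘⟨ const-∘) sign-true))
peq-truth-value Nat     t = conjunction-truth-value _ _ t
peq-truth-value (A ⊗ B) t = conjunction-truth-value _ _ t

-- Main lemma: at any stage, true = [f ≐_B g] implies f = g.  For ℕ both [f ≤ g] and
-- [g ≤ f] are true, so f ∸ g = g ∸ f = 0; for products argue componentwise.
peq-reflects : ∀ B {X} (f g : Map X B) → true ≈ peq B ∘ ⟨ f , g ⟩ → f ≈ g
peq-reflects 𝟏 f g _ = trans Π-unique (sym Π-unique)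
peq-reflects Nat f g eq =
  monus-antisym f g (neg-true⇒zero _ (proj₁ both)) (neg-true⇒zero _ (proj₂ both))
  where
  swap-pair : ⟨ r , ℓ ⟩ ∘ ⟨ f , g ⟩ ≈ ⟨ g , f ⟩
  swap-pair = trans pair-∘ (⟨⟩-cong r-β ℓ-β)

  unfold-peq : peq Nat ∘ ⟨ f , g ⟩ ≈ sign ∘ (mult ∘ ⟨ neg ∘ (f ∸ₘ g) , neg ∘ (g ∸ₘ f) ⟩)
  unfold-peq = trans (and-at _ _ _) (refl ⟩∘⟨ refl ⟩∘⟨ ⟨⟩-cong assoc (trans assoc (trans assoc (refl ⟩∘⟨ refl ⟩∘⟨ swap-pair))))

  both : (neg ∘ (f ∸ₘ g) ≈ true) × (neg ∘ (g ∸ₘ f) ≈ true)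
  both = conjuncts-true _ _ (neg-is-truth-value _) (neg-is-truth-value _) (sym (trans eq unfold-peq))
peq-reflects (A ⊗ B) f g eq = begin
  f                  ≈⟨ sym ⟨⟩-η ⟩
  ⟨ ℓ ∘ f , r ∘ f ⟩  ≈⟨ ⟨⟩-cong (peq-reflects A _ _ (sym (proj₁ both))) (peq-reflects B _ _ (sym (proj₂ both))) ⟩
  ⟨ ℓ ∘ g , r ∘ g ⟩  ≈⟨ ⟨⟩-η ⟩
  g                  ∎
  where
  unfold-peq : peq (A ⊗ B) ∘ ⟨ f , g ⟩ ≈ sign ∘ (mult ∘ ⟨ peq A ∘ ⟨ ℓ ∘ f , ℓ ∘ g ⟩ , peq B ∘ ⟨ r ∘ f , r ∘ g ⟩ ⟩)
  unfold-peq = trans (and-at _ _ _) (refl ⟩∘⟨ refl ⟩∘⟨ ⟨⟩-cong (trans assoc (refl ⟩∘⟨ ×-∘-pair))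
                                                               (trans assoc (refl ⟩∘⟨ ×-∘-pair)))

  both : (peq A ∘ ⟨ ℓ ∘ f , ℓ ∘ g ⟩ ≈ true) × (peq B ∘ ⟨ r ∘ f , r ∘ g ⟩ ≈ true)
  both = conjuncts-true _ _ (peq-truth-value A _) (peq-truth-value B _) (sym (trans eq unfold-peq))

mainTheorem1 : {A B : Obj} (f g : Map A B) →
    true ≈ peq B ∘ (f ×ᵐ g) ∘ Δ →
    f ≈ g
mainTheorem1 {B = B} f g eq = peq-reflects B f g (trans eq (refl ⟩∘⟨ at-diagonal))
  where
  at-diagonal : (f ×ᵐ g) ∘ Δ ≈ ⟨ f , g ⟩
  at-diagonal = trans ×-∘-pair (⟨⟩-cong idʳ idʳ)
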